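{- Let $n\ge1$ be an integer and $k\in\mathbb{R}\setminus C_n$. Then there is a unique pair $(a,b)\in\mathbb{R}^2$ with $(a,b)\neq(0,0)$ satisfying both $S_{k,n+1}^{(a,b)}+S_{k,n}^{(a,b)}=bk+2b+a$ and $4a^3+27b^2=0$; namely $a=-\frac{27(P_n(k)-1)^2}{4(Q_n(k)-k-2)^2}$, $b=\frac{27(P_n(k)-1)^3}{4(Q_n(k)-k-2)^3}$.
   Context: For real $k,a,b$, the generalized $k$-FL sequence is $S_{k,0}^{(a,b)}=2b$, $S_{k,1}^{(a,b)}=bk+a$, $S_{k,n}^{(a,b)}=kS_{k,n-1}^{(a,b)}+S_{k,n-2}^{(a,b)}$ ($n\ge2$). Define $f_n,l_n\in\mathbb{Z}[T]$ by $f_0=0,f_1=1,l_0=2,l_1=T$, $f_n=Tf_{n-1}+f_{n-2}$, $l_n=Tl_{n-1}+l_{n-2}$; $P_n=f_{n+1}+f_n$, $Q_n=l_{n+1}+l_n$ (so $S_{k,n+1}^{(a,b)}+S_{k,n}^{(a,b)}=P_n(k)a+Q_n(k)b$), and $C_n=\{k\in\mathbb{R}\mid P_n(k)-1=0\text{ or }Q_n(k)-k-2=0\}$. -}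

module Defs where

open import Level using (0ℓ)
open import Data.Nat using (ℕ; zero; suc)
open import Data.Product using (Σ; _×_)
open import Relation.Binary.PropositionalEquality using (_≡_)
open import Relation.Binary.Structures using (IsStrictTotalOrder)
open import Relation.Nullary using (¬_)
open import Data.Sum using (_⊎_)
open import Algebra.Structures using (IsCommutativeRing)

-- Agda's standard library has no real numbers.  We axiomatise them as a
-- complete ordered field (unique up to isomorphism, hence this is ℝ).
-- Equality is propositional equality on the carrier.
record RealNumbers : Set₁ where
  infixl 6 _+_ _-_
  infixl 7 _*_ _/_
  infix 8 -_
  infixr 9 _^_
  infix 4 _<_ _≤_
  field
    ℝ    : Set
    _+_  : ℝ → ℝ → ℝ
    _*_  : ℝ → ℝ → ℝ
    -_   : ℝ → ℝ
    0ℝ   : ℝ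
    1ℝ   : ℝ
    _⁻¹  : ℝ → ℝ   -- total; value at 0 is irrelevant
    _<_  : ℝ → ℝ → Set
    isCommutativeRing : IsCommutativeRing _≡_ _+_ _*_ -_ 0ℝ 1ℝ
    ⁻¹-inverse : ∀ x → ¬ (x ≡ 0ℝ) → x * (x ⁻¹) ≡ 1ℝ
    0≢1 : ¬ (0ℝ ≡ 1ℝ)
    isStrictTotalOrder : IsStrictTotalOrder _≡_ _<_
    +-mono-< : ∀ {x y} z → x < y → x + z < y + z
    *-pos    : ∀ {x y} → 0ℝ < x → 0ℝ < y → 0ℝ < x * y
  _≤_ : ℝ → ℝ → Set
  x ≤ y = (x < y) ⊎ (x ≡ y)
  field
    complete : (P : ℝ → Set) → Σ ℝ P → Σ ℝ (λ u → ∀ x → P x → x ≤ u) →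
               Σ ℝ (λ s → (∀ x → P x → x ≤ s) ×
                          (∀ u → (∀ x → P x → x ≤ u) → s ≤ u))

  _-_ : ℝ → ℝ → ℝ
  x - y = x + (- y)

  _/_ : ℝ → ℝ → ℝ
  x / y = x * (y ⁻¹)

  fromℕ : ℕ → ℝ
  fromℕ zero    = 0ℝ
  fromℕ (suc n) = 1ℝ + fromℕ n

  _^_ : ℝ → ℕ → ℝ
  x ^ zero  = 1ℝ
  x ^ suc n = x * (x ^ n)

  S : ℝ → ℝ → ℝ → ℕ → ℝ
  S k a b zero          = fromℕ 2 * b
  S k a b (suc zero)    = b * k + a
  S k a b (suc (suc n)) = k * S k a b (suc n) + S k a b n

  -- evaluations at T = k of the polynomials f_n, l_n ∈ ℤ[T]
  f : ℕ → ℝ → ℝ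
  f zero          k = 0ℝ
  f (suc zero)    k = 1ℝ
  f (suc (suc n)) k = k * f (suc n) k + f n k

  l : ℕ → ℝ → ℝ
  l zero          k = fromℕ 2
  l (suc zero)    k = k
  l (suc (suc n)) k = k * l (suc n) k + l n k

  P : ℕ → ℝ → ℝ
  P n k = f (suc n) k + f n k

  Q : ℕ → ℝ → ℝ
  Q n k = l (suc n) k + l n k

  _∈C_ : ℝ → ℕ → Set
  k ∈C n = (P n k - 1ℝ ≡ 0ℝ) ⊎ (Q n k - k - fromℕ 2 ≡ 0ℝ)

-- S_{k,n+1} + S_{k,n} is linear in (a, b), namely P_n(k) a + Q_n(k) b, so the first
-- condition says that (a, b) lies on the line p a + q b = 0 with p = P_n(k) - 1 and
-- q = Q_n(k) - k - 2.  For q ≠ 0 this line meets the cuspidal cubic 4a³ + 27b² = 0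
-- only at the origin and at one further point: eliminating b gives
-- a² (4 a q² + 27 p²) = q² (4a³ + 27b²) + 27 (p a + q b)(p a - q b) = 0,
-- which forces a = -27p²/(4q²) once a ≠ 0, and then b = -p a / q = 27p³/(4q³).
-- For p ≠ 0 that point is not the origin.

module Submission where

open import Algebra.Bundles using (CommutativeRing)
import Algebra.Properties.AbelianGroup
import Algebra.Properties.Group
import Algebra.Properties.Ring
import Algebra.Properties.Semiring.Mult.TCOptimised
import Algebra.Solver.Ring
open import Algebra.Solver.Ring.AlmostCommutativeRing
  using (fromCommutativeRing; _-Raw-AlmostCommutative⟶_)
import Algebra.Solver.Ring.NaturalCoefficients.Default
open import Data.Empty using (⊥-elim)
open import Data.Integer.Base as ℤ using (ℤ; +_; -[1+_]; _⊖_; _◃_; sign; ∣_∣)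
import Data.Integer.Properties as ℤ
open import Data.Maybe.Base using (map)
open import Data.Nat using (ℕ; zero; suc; _≥_)
import Data.Nat as ℕ
open import Data.Nat.Properties using (+-suc)
open import Data.Sign.Base as Sign using (Sign)
open import Data.Sum.Base using (inj₁; inj₂)
open import Function.Base using (_∘_)
open import Function.Bundles using (_⇔_; mk⇔; Equivalence)
open import Relation.Binary.Consequences using (dec⇒weaklyDec)
open import Relation.Binary.Definitions using (tri<; tri≈; tri>)
import Relation.Binary.PropositionalEquality as ≡
open ≡ using (_≡_)
import Relation.Binary.Structures
open import Relation.Nullary using (¬_)

-- The ring solver needs coefficients with decidable equality; ℤ maps into every
-- commutative ring.
module IntegerCoefficients {c ℓ} (R : CommutativeRing c ℓ) where
  open CommutativeRing R
  open Algebra.Properties.Semiring.Mult.TCOptimised semiring using (_×_; 1+×; ×-homo-+; ×1-homo-*)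
  open Algebra.Properties.Group +-group using (ε⁻¹≈ε; ⁻¹-involutive)
  open Algebra.Properties.AbelianGroup +-abelianGroup using (⁻¹-∙-comm)
  open Algebra.Properties.Ring ring using (-1*x≈-x)
  open import Relation.Binary.Reasoning.Setoid setoid

  -- With the optimised multiplication, 1 × 1# is 1# itself, so `con (+ 1)` in a
  -- solver equation denotes 1# on the nose and `refl` suffices.
  fromℤ : ℤ → Carrier
  fromℤ (+ n)    = n × 1#
  fromℤ -[1+ n ] = - (suc n × 1#)

  private
    [x+a]-[x+b]≈a-b : ∀ x a b → (x + a) - (x + b) ≈ a - b
    [x+a]-[x+b]≈a-b x a b = begin
      (x + a) - (x + b)       ≈⟨ +-congˡ (⁻¹-∙-comm x b) ⟨
      (x + a) + (- x + - b)
        ≈⟨ solve 4 (λ x a x⁻ b⁻ → (x :+ a) :+ (x⁻ :+ b⁻) := (a :+ b⁻) :+ (x :+ x⁻)) refl x a (- x) (- b) ⟩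
      (a - b) + (x - x)       ≈⟨ +-congˡ (-‿inverseʳ x) ⟩
      (a - b) + 0#            ≈⟨ +-identityʳ _ ⟩
      a - b                   ∎
      where open Algebra.Solver.Ring.NaturalCoefficients.Default commutativeSemiring

  fromℤ-⊖ : ∀ m n → fromℤ (m ⊖ n) ≈ m × 1# - n × 1#
  fromℤ-⊖ zero    zero    = sym (-‿inverseʳ 0#)
  fromℤ-⊖ (suc m) zero    = sym (trans (+-congˡ ε⁻¹≈ε) (+-identityʳ _))
  fromℤ-⊖ zero    (suc n) = sym (+-identityˡ _)
  fromℤ-⊖ (suc m) (suc n) = begin
    fromℤ (suc m ⊖ suc n)            ≡⟨ ≡.cong fromℤ (ℤ.[1+m]⊖[1+n]≡m⊖n m n) ⟩
    fromℤ (m ⊖ n)                    ≈⟨ fromℤ-⊖ m n ⟩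
    m × 1# - n × 1#                  ≈⟨ [x+a]-[x+b]≈a-b 1# (m × 1#) (n × 1#) ⟨
    (1# + m × 1#) - (1# + n × 1#)    ≈⟨ +-cong (1+× m 1#) (-‿cong (1+× n 1#)) ⟨
    suc m × 1# - suc n × 1#          ∎

  fromℤ-neg : ∀ i → fromℤ (ℤ.- i) ≈ - fromℤ i
  fromℤ-neg -[1+ n ]    = sym (⁻¹-involutive _)
  fromℤ-neg (+ zero)    = sym ε⁻¹≈ε
  fromℤ-neg (+ suc n)   = refl

  fromℤ-+ : ∀ i j → fromℤ (i ℤ.+ j) ≈ fromℤ i + fromℤ j
  fromℤ-+ (+ m)     (+ n)     = ×-homo-+ 1# m n
  fromℤ-+ (+ m)     -[1+ n ]  = fromℤ-⊖ m (suc n)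
  fromℤ-+ -[1+ m ]  (+ n)     = trans (fromℤ-⊖ n (suc m)) (+-comm _ _)
  fromℤ-+ -[1+ m ]  -[1+ n ]  = begin
    - (suc (suc (m ℕ.+ n)) × 1#)           ≡⟨ ≡.cong (λ k → - (suc k × 1#)) (+-suc m n) ⟨
    - ((suc m ℕ.+ suc n) × 1#)             ≈⟨ -‿cong (×-homo-+ 1# (suc m) (suc n)) ⟩
    - (suc m × 1# + suc n × 1#)            ≈⟨ ⁻¹-∙-comm _ _ ⟨
    - (suc m × 1#) + - (suc n × 1#)        ∎

  fromSign : Sign → Carrier
  fromSign Sign.+ = 1#
  fromSign Sign.- = - 1#

  fromSign-* : ∀ s t → fromSign (s Sign.* t) ≈ fromSign s * fromSign t
  fromSign-* Sign.+ t      = sym (*-identityˡ _)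
  fromSign-* Sign.- Sign.+ = sym (*-identityʳ _)
  fromSign-* Sign.- Sign.- = sym (trans (-1*x≈-x (- 1#)) (⁻¹-involutive 1#))

  fromℤ-◃ : ∀ s n → fromℤ (s ◃ n) ≈ fromSign s * n × 1#
  fromℤ-◃ s      zero    = sym (zeroʳ _)
  fromℤ-◃ Sign.+ (suc n) = sym (*-identityˡ _)
  fromℤ-◃ Sign.- (suc n) = sym (-1*x≈-x _)

  fromℤ-* : ∀ i j → fromℤ (i ℤ.* j) ≈ fromℤ i * fromℤ j
  fromℤ-* i j = begin
    fromℤ ((sign i Sign.* sign j) ◃ (∣ i ∣ ℕ.* ∣ j ∣))
      ≈⟨ fromℤ-◃ (sign i Sign.* sign j) (∣ i ∣ ℕ.* ∣ j ∣) ⟩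
    fromSign (sign i Sign.* sign j) * (∣ i ∣ ℕ.* ∣ j ∣) × 1#
      ≈⟨ *-cong (fromSign-* (sign i) (sign j)) (×1-homo-* ∣ i ∣ ∣ j ∣) ⟩
    (fromSign (sign i) * fromSign (sign j)) * (∣ i ∣ × 1# * ∣ j ∣ × 1#)
      ≈⟨ solve 4 (λ s t m n → (s :* t) :* (m :* n) := (s :* m) :* (t :* n)) refl _ _ _ _ ⟩
    (fromSign (sign i) * ∣ i ∣ × 1#) * (fromSign (sign j) * ∣ j ∣ × 1#)
      ≈⟨ *-cong (fromℤ-◃ (sign i) ∣ i ∣) (fromℤ-◃ (sign j) ∣ j ∣) ⟨
    fromℤ (sign i ◃ ∣ i ∣) * fromℤ (sign j ◃ ∣ j ∣)
      ≡⟨ ≡.cong₂ (λ i j → fromℤ i * fromℤ j) (ℤ.◃-inverse i) (ℤ.◃-inverse j) ⟩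
    fromℤ i * fromℤ j ∎
    where open Algebra.Solver.Ring.NaturalCoefficients.Default commutativeSemiring

  fromℤ-homomorphism : ℤ.+-*-rawRing -Raw-AlmostCommutative⟶ fromCommutativeRing R
  fromℤ-homomorphism = record
    { ⟦_⟧    = fromℤ
    ; +-homo = fromℤ-+
    ; *-homo = fromℤ-*
    ; -‿homo = fromℤ-neg
    ; 0-homo = refl
    ; 1-homo = refl
    }

  open Algebra.Solver.Ring ℤ.+-*-rawRing (fromCommutativeRing R) fromℤ-homomorphism
    (λ i j → map (λ i≡j → reflexive (≡.cong fromℤ i≡j)) (dec⇒weaklyDec ℤ._≟_ i j)) public

open import Data.Product.Base using (_×_; _,_)
open import Defs

module RealNumberProperties (R : RealNumbers) where
  open RealNumbers R
  open ≡ using (refl; sym; trans; cong; cong₂; subst; subst₂; module ≡-Reasoning)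
  open ≡-Reasoning

  commutativeRing : CommutativeRing _ _
  commutativeRing = record { isCommutativeRing = isCommutativeRing }

  open CommutativeRing commutativeRing
    using ( +-identityˡ; +-identityʳ; *-identityˡ; *-identityʳ; zeroˡ; zeroʳ
          ; -‿inverseʳ; *-assoc; +-group; ring)
  open Algebra.Properties.Group +-group using (x∙y⁻¹≈ε⇒x≈y; x≈y⇒x∙y⁻¹≈ε)
  open Algebra.Properties.Ring ring using (-‿distribˡ-*)
  open Relation.Binary.Structures.IsStrictTotalOrder isStrictTotalOrder using (compare; irrefl)
    renaming (trans to <-trans)
  open IntegerCoefficients commutativeRing using (solve; _:=_; _:+_; _:*_; _:-_; :-_; _:^_; con)

  0<1 : 0ℝ < 1ℝ
  0<1 with compare 0ℝ 1ℝ
  ... | tri< 0<1 _ _ = 0<1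
  ... | tri≈ _ 0≡1 _ = ⊥-elim (0≢1 0≡1)
  ... | tri> _ _ 1<0 = ⊥-elim (irrefl refl (<-trans [-1]*[-1]>0 1<0))
    where
    -1>0 : 0ℝ < - 1ℝ
    -1>0 = subst₂ _<_ (-‿inverseʳ 1ℝ) (+-identityˡ (- 1ℝ)) (+-mono-< (- 1ℝ) 1<0)
    [-1]*[-1]>0 : 0ℝ < 1ℝ
    [-1]*[-1]>0 = subst (0ℝ <_) (solve 0 ((:- con (+ 1)) :* (:- con (+ 1)) := con (+ 1)) refl)
                                (*-pos -1>0 -1>0)

  fromℕ-suc>0 : ∀ m → 0ℝ < fromℕ (suc m)
  fromℕ-suc>0 zero    = subst (0ℝ <_) (sym (+-identityʳ 1ℝ)) 0<1
  fromℕ-suc>0 (suc m) =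
    <-trans (fromℕ-suc>0 m) (subst₂ _<_ (+-identityˡ _) refl (+-mono-< (fromℕ (suc m)) 0<1))

  fromℕ-suc≢0 : ∀ m → ¬ fromℕ (suc m) ≡ 0ℝ
  fromℕ-suc≢0 m eq = irrefl refl (subst (0ℝ <_) eq (fromℕ-suc>0 m))

  x*y≡z⇒x≡z/y : ∀ {x y z} → ¬ y ≡ 0ℝ → x * y ≡ z → x ≡ z / y
  x*y≡z⇒x≡z/y {x} {y} {z} y≢0 xy≡z = begin
    x                ≡⟨ *-identityʳ x ⟨
    x * 1ℝ           ≡⟨ cong (x *_) (⁻¹-inverse y y≢0) ⟨
    x * (y * y ⁻¹)   ≡⟨ *-assoc x y (y ⁻¹) ⟨
    (x * y) * y ⁻¹   ≡⟨ cong (_* y ⁻¹) xy≡z ⟩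
    z / y            ∎

  x*y≡1⇒x≡y⁻¹ : ∀ {x y} → ¬ y ≡ 0ℝ → x * y ≡ 1ℝ → x ≡ y ⁻¹
  x*y≡1⇒x≡y⁻¹ y≢0 xy≡1 = trans (x*y≡z⇒x≡z/y y≢0 xy≡1) (*-identityˡ _)

  x*y≡0⇒x≡0 : ∀ {x y} → ¬ y ≡ 0ℝ → x * y ≡ 0ℝ → x ≡ 0ℝ
  x*y≡0⇒x≡0 y≢0 xy≡0 = trans (x*y≡z⇒x≡z/y y≢0 xy≡0) (zeroˡ _)

  *-≢0 : ∀ {x y} → ¬ x ≡ 0ℝ → ¬ y ≡ 0ℝ → ¬ x * y ≡ 0ℝ
  *-≢0 x≢0 y≢0 xy≡0 = x≢0 (x*y≡0⇒x≡0 y≢0 xy≡0)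

  ^-≢0 : ∀ {x} → ¬ x ≡ 0ℝ → ∀ m → ¬ x ^ m ≡ 0ℝ
  ^-≢0 x≢0 zero    = λ 1≡0 → 0≢1 (sym 1≡0)
  ^-≢0 x≢0 (suc m) = *-≢0 x≢0 (^-≢0 x≢0 m)

  ⁻¹-≢0 : ∀ {x} → ¬ x ≡ 0ℝ → ¬ x ⁻¹ ≡ 0ℝ
  ⁻¹-≢0 {x} x≢0 x⁻¹≡0 = 0≢1 (begin
    0ℝ         ≡⟨ zeroʳ x ⟨
    x * 0ℝ     ≡⟨ cong (x *_) x⁻¹≡0 ⟨
    x * x ⁻¹   ≡⟨ ⁻¹-inverse x x≢0 ⟩
    1ℝ         ∎)

  OnCusp : ℝ → ℝ → Set
  OnCusp a b = fromℕ 4 * a ^ 3 + fromℕ 27 * b ^ 2 ≡ 0ℝ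

  cuspA cuspB : ℝ → ℝ → ℝ
  cuspA p q = - ((fromℕ 27 * p ^ 2) / (fromℕ 4 * q ^ 2))
  cuspB p q = (fromℕ 27 * p ^ 3) / (fromℕ 4 * q ^ 3)

  cusp-point : ∀ {p q} → ¬ p ≡ 0ℝ → ¬ q ≡ 0ℝ →
    ¬ (cuspA p q ≡ 0ℝ × cuspB p q ≡ 0ℝ) ×
    p * cuspA p q + q * cuspB p q ≡ 0ℝ ×
    OnCusp (cuspA p q) (cuspB p q)
  cusp-point {p} {q} p≢0 q≢0 = (λ (_ , B≡0) → B≢0 B≡0) , on-line , on-cusp
    where
    4q³≢0 : ¬ fromℕ 4 * q ^ 3 ≡ 0ℝ
    4q³≢0 = *-≢0 (fromℕ-suc≢0 3) (^-≢0 q≢0 3)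

    v : ℝ
    v = (fromℕ 4 * q ^ 3) ⁻¹

    4q³v≡1 : fromℕ 4 * q ^ 3 * v ≡ 1ℝ
    4q³v≡1 = ⁻¹-inverse _ 4q³≢0

    [4q²]⁻¹≡qv : (fromℕ 4 * q ^ 2) ⁻¹ ≡ q * v
    [4q²]⁻¹≡qv = sym (x*y≡1⇒x≡y⁻¹ (*-≢0 (fromℕ-suc≢0 3) (^-≢0 q≢0 2)) (begin
      q * v * (fromℕ 4 * q ^ 2)
        ≡⟨ solve 3 (λ q v c → q :* v :* (c :* q :^ 2) := c :* q :^ 3 :* v) refl q v (fromℕ 4) ⟩
      fromℕ 4 * q ^ 3 * v         ≡⟨ 4q³v≡1 ⟩
      1ℝ                          ∎))

    B≢0 : ¬ cuspB p q ≡ 0ℝ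
    B≢0 = *-≢0 (*-≢0 (fromℕ-suc≢0 26) (^-≢0 p≢0 3)) (⁻¹-≢0 4q³≢0)

    on-line : p * cuspA p q + q * cuspB p q ≡ 0ℝ
    on-line = begin
      p * cuspA p q + q * cuspB p q
        ≡⟨ cong (λ w → p * - (fromℕ 27 * p ^ 2 * w) + q * cuspB p q) [4q²]⁻¹≡qv ⟩
      p * - (fromℕ 27 * p ^ 2 * (q * v)) + q * (fromℕ 27 * p ^ 3 * v)
        ≡⟨ solve 4 (λ c p q v → p :* :- (c :* p :^ 2 :* (q :* v)) :+ q :* (c :* p :^ 3 :* v) := con (+ 0))
                   refl (fromℕ 27) p q v ⟩
      0ℝ ∎

    on-cusp : OnCusp (cuspA p q) (cuspB p q)
    on-cusp = begin
      fromℕ 4 * cuspA p q ^ 3 + fromℕ 27 * cuspB p q ^ 2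
        ≡⟨ cong (λ w → fromℕ 4 * (- (fromℕ 27 * p ^ 2 * w)) ^ 3 + fromℕ 27 * cuspB p q ^ 2)
                [4q²]⁻¹≡qv ⟩
      fromℕ 4 * (- (fromℕ 27 * p ^ 2 * (q * v))) ^ 3 + fromℕ 27 * (fromℕ 27 * p ^ 3 * v) ^ 2
        ≡⟨ solve 5 (λ c₄ c p q v →
               c₄ :* (:- (c :* p :^ 2 :* (q :* v))) :^ 3 :+ c :* (c :* p :^ 3 :* v) :^ 2
               := c :^ 3 :* p :^ 6 :* v :^ 2 :* (con (+ 1) :- c₄ :* q :^ 3 :* v))
             refl (fromℕ 4) (fromℕ 27) p q v ⟩
      fromℕ 27 ^ 3 * p ^ 6 * v ^ 2 * (1ℝ - fromℕ 4 * q ^ 3 * v)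
        ≡⟨ cong (λ t → fromℕ 27 ^ 3 * p ^ 6 * v ^ 2 * (1ℝ - t)) 4q³v≡1 ⟩
      fromℕ 27 ^ 3 * p ^ 6 * v ^ 2 * (1ℝ - 1ℝ)
        ≡⟨ solve 1 (λ y → y :* (con (+ 1) :- con (+ 1)) := con (+ 0))
                   refl (fromℕ 27 ^ 3 * p ^ 6 * v ^ 2) ⟩
      0ℝ ∎

  cusp-point-unique : ∀ {p q a b} → ¬ q ≡ 0ℝ → ¬ (a ≡ 0ℝ × b ≡ 0ℝ) →
    p * a + q * b ≡ 0ℝ → OnCusp a b → a ≡ cuspA p q × b ≡ cuspB p q
  cusp-point-unique {p} {q} {a} {b} q≢0 ab≢0 on-line on-cusp = a≡A , b≡B
    where
    a≢0 : ¬ a ≡ 0ℝ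
    a≢0 refl = ab≢0 (refl , x*y≡0⇒x≡0 q≢0 (trans b*q≡p*0+q*b on-line))
      where
      b*q≡p*0+q*b : b * q ≡ p * 0ℝ + q * b
      b*q≡p*0+q*b = solve 3 (λ p q b → b :* q := p :* con (+ 0) :+ q :* b) refl p q b

    4aq²+27p² : ℝ
    4aq²+27p² = fromℕ 4 * a * q ^ 2 + fromℕ 27 * p ^ 2

    4aq²+27p²≡0 : 4aq²+27p² ≡ 0ℝ
    4aq²+27p²≡0 = x*y≡0⇒x≡0 (^-≢0 a≢0 2) (begin
      4aq²+27p² * a ^ 2
        ≡⟨ solve 6 (λ c₄ c p q a b → (c₄ :* a :* q :^ 2 :+ c :* p :^ 2) :* a :^ 2
             := q :^ 2 :* (c₄ :* a :^ 3 :+ c :* b :^ 2) :+ c :* (p :* a :+ q :* b) :* (p :* a :- q :* b))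
             refl (fromℕ 4) (fromℕ 27) p q a b ⟩
      q ^ 2 * (fromℕ 4 * a ^ 3 + fromℕ 27 * b ^ 2) + fromℕ 27 * (p * a + q * b) * (p * a - q * b)
        ≡⟨ cong₂ (λ s t → q ^ 2 * s + fromℕ 27 * t * (p * a - q * b)) on-cusp on-line ⟩
      q ^ 2 * 0ℝ + fromℕ 27 * 0ℝ * (p * a - q * b)
        ≡⟨ solve 3 (λ q c x → q :^ 2 :* con (+ 0) :+ c :* con (+ 0) :* x := con (+ 0))
                   refl q (fromℕ 27) (p * a - q * b) ⟩
      0ℝ ∎)

    a≡A : a ≡ cuspA p q
    a≡A = trans (x*y≡z⇒x≡z/y (*-≢0 (fromℕ-suc≢0 3) (^-≢0 q≢0 2)) (begin
      a * (fromℕ 4 * q ^ 2)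
        ≡⟨ solve 5 (λ c₄ c p q a → a :* (c₄ :* q :^ 2) := c₄ :* a :* q :^ 2 :+ c :* p :^ 2 :- c :* p :^ 2)
                   refl (fromℕ 4) (fromℕ 27) p q a ⟩
      4aq²+27p² - fromℕ 27 * p ^ 2           ≡⟨ cong (_- fromℕ 27 * p ^ 2) 4aq²+27p²≡0 ⟩
      0ℝ - fromℕ 27 * p ^ 2          ≡⟨ +-identityˡ _ ⟩
      - (fromℕ 27 * p ^ 2)           ∎))
      (sym (-‿distribˡ-* _ _))

    b≡B : b ≡ cuspB p q
    b≡B = x*y≡z⇒x≡z/y (*-≢0 (fromℕ-suc≢0 3) (^-≢0 q≢0 3)) (begin
      b * (fromℕ 4 * q ^ 3)
        ≡⟨ solve 6 (λ c₄ c p q a b → b :* (c₄ :* q :^ 3)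
             := c₄ :* q :^ 2 :* (p :* a :+ q :* b) :- p :* (c₄ :* a :* q :^ 2 :+ c :* p :^ 2) :+ c :* p :^ 3)
             refl (fromℕ 4) (fromℕ 27) p q a b ⟩
      fromℕ 4 * q ^ 2 * (p * a + q * b) - p * 4aq²+27p² + fromℕ 27 * p ^ 3
        ≡⟨ cong₂ (λ s t → fromℕ 4 * q ^ 2 * s - p * t + fromℕ 27 * p ^ 3) on-line 4aq²+27p²≡0 ⟩
      fromℕ 4 * q ^ 2 * 0ℝ - p * 0ℝ + fromℕ 27 * p ^ 3
        ≡⟨ solve 4 (λ c₄ c p q → c₄ :* q :^ 2 :* con (+ 0) :- p :* con (+ 0) :+ c :* p :^ 3 := c :* p :^ 3)
                   refl (fromℕ 4) (fromℕ 27) p q ⟩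
      fromℕ 27 * p ^ 3 ∎)

  S≡f*a+l*b : ∀ k a b m → S k a b m ≡ f m k * a + l m k * b
  S≡f*a+l*b k a b zero =
    solve 3 (λ c a b → c :* b := con (+ 0) :* a :+ c :* b) refl (fromℕ 2) a b
  S≡f*a+l*b k a b (suc zero) =
    solve 3 (λ k a b → b :* k :+ a := con (+ 1) :* a :+ k :* b) refl k a b
  S≡f*a+l*b k a b (suc (suc m)) = begin
    k * S k a b (suc m) + S k a b m
      ≡⟨ cong₂ (λ s t → k * s + t) (S≡f*a+l*b k a b (suc m)) (S≡f*a+l*b k a b m) ⟩
    k * (f (suc m) k * a + l (suc m) k * b) + (f m k * a + l m k * b)
      ≡⟨ solve 7 (λ k f₁ f₀ l₁ l₀ a b → k :* (f₁ :* a :+ l₁ :* b) :+ (f₀ :* a :+ l₀ :* b)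
                   := (k :* f₁ :+ f₀) :* a :+ (k :* l₁ :+ l₀) :* b)
                 refl k (f (suc m) k) (f m k) (l (suc m) k) (l m k) a b ⟩
    (k * f (suc m) k + f m k) * a + (k * l (suc m) k + l m k) * b ∎

  S-suc+S≡P*a+Q*b : ∀ k a b n → S k a b (suc n) + S k a b n ≡ P n k * a + Q n k * b
  S-suc+S≡P*a+Q*b k a b n = begin
    S k a b (suc n) + S k a b n
      ≡⟨ cong₂ _+_ (S≡f*a+l*b k a b (suc n)) (S≡f*a+l*b k a b n) ⟩
    (f (suc n) k * a + l (suc n) k * b) + (f n k * a + l n k * b)
      ≡⟨ solve 6 (λ f₁ f₀ l₁ l₀ a b → (f₁ :* a :+ l₁ :* b) :+ (f₀ :* a :+ l₀ :* b)
                   := (f₁ :+ f₀) :* a :+ (l₁ :+ l₀) :* b)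
                 refl (f (suc n) k) (f n k) (l (suc n) k) (l n k) a b ⟩
    P n k * a + Q n k * b ∎

  S-suc+S≡⇔onLine : ∀ {k a b} n →
    (S k a b (suc n) + S k a b n ≡ b * k + fromℕ 2 * b + a) ⇔
    ((P n k - 1ℝ) * a + (Q n k - k - fromℕ 2) * b ≡ 0ℝ)
  S-suc+S≡⇔onLine {k} {a} {b} n =
    mk⇔ (λ eq → trans (sym difference) (x≈y⇒x∙y⁻¹≈ε eq))
        (λ eq → x∙y⁻¹≈ε⇒x≈y _ _ (trans difference eq))
    where
    difference : (S k a b (suc n) + S k a b n) - (b * k + fromℕ 2 * b + a)
               ≡ (P n k - 1ℝ) * a + (Q n k - k - fromℕ 2) * b
    difference = begin
      (S k a b (suc n) + S k a b n) - (b * k + fromℕ 2 * b + a)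
        ≡⟨ cong (_- (b * k + fromℕ 2 * b + a)) (S-suc+S≡P*a+Q*b k a b n) ⟩
      (P n k * a + Q n k * b) - (b * k + fromℕ 2 * b + a)
        ≡⟨ solve 6 (λ P Q k c a b → (P :* a :+ Q :* b) :- (b :* k :+ c :* b :+ a)
                     := (P :- con (+ 1)) :* a :+ (Q :- k :- c) :* b)
                   refl (P n k) (Q n k) k (fromℕ 2) a b ⟩
      (P n k - 1ℝ) * a + (Q n k - k - fromℕ 2) * b ∎

mainTheorem17 : (R : RealNumbers) → let open RealNumbers R in
  (n : ℕ) → n ≥ 1 → (k : ℝ) → ¬ (k ∈C n) →
  let A = - ((fromℕ 27 * (P n k - 1ℝ) ^ 2) / (fromℕ 4 * (Q n k - k - fromℕ 2) ^ 2))
      B = (fromℕ 27 * (P n k - 1ℝ) ^ 3) / (fromℕ 4 * (Q n k - k - fromℕ 2) ^ 3)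
  in (¬ (A ≡ 0ℝ × B ≡ 0ℝ)
      × S k A B (Data.Nat.suc n) + S k A B n ≡ B * k + fromℕ 2 * B + A
      × fromℕ 4 * A ^ 3 + fromℕ 27 * B ^ 2 ≡ 0ℝ)
     × ((a b : ℝ) → ¬ (a ≡ 0ℝ × b ≡ 0ℝ) →
        S k a b (Data.Nat.suc n) + S k a b n ≡ b * k + fromℕ 2 * b + a →
        fromℕ 4 * a ^ 3 + fromℕ 27 * b ^ 2 ≡ 0ℝ →
        a ≡ A × b ≡ B)
mainTheorem17 R n _ k k∉Cₙ =
  let (AB≢0 , on-line , on-cusp) = cusp-point p≢0 q≢0
  in (AB≢0 , Equivalence.from (S-suc+S≡⇔onLine n) on-line , on-cusp) ,
     λ a b ab≢0 S-condition cusp-ab →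
       cusp-point-unique q≢0 ab≢0 (Equivalence.to (S-suc+S≡⇔onLine n) S-condition) cusp-ab
  where
  open RealNumbers R
  open RealNumberProperties R

  p≢0 : ¬ P n k - 1ℝ ≡ 0ℝ
  p≢0 = k∉Cₙ ∘ inj₁

  q≢0 : ¬ Q n k - k - fromℕ 2 ≡ 0ℝ
  q≢0 = k∉Cₙ ∘ inj₂
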